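{- Let $\Gamma$ be a finite $G$-arc-transitive digraph of valency $5$, where $G\leq\mathrm{Aut}(\Gamma)$. If $|\Gamma^+(u)\cap\Gamma^+(v)|=2$ for some arc $(u,v)$, then $\Gamma$ is not $(G,2)$-geodesic-transitive.
   Context: A digraph $\Gamma$ consists of a finite vertex set $V(\Gamma)$ with an antisymmetric irreflexive relation $\rightarrow$; an arc is an ordered pair $(u,v)$ with $u\rightarrow v$; $\Gamma^+(v)=\{w: v\rightarrow w\}$ and the valency is $|\Gamma^+(v)|$. $G$-arc-transitive means $G$ is transitive on arcs. The distance $d_\Gamma(u,v)$ is the length of a shortest directed path from $u$ to $v$. An $s$-arc is a sequence $(v_0,\dots,v_s)$ with $v_i\rightarrow v_{i+1}$ for all $i$; it is an $s$-geodesic if $d_\Gamma(v_0,v_s)=s$. $\Gamma$ is $(G,s)$-geodesic-transitive if $G$ is transitive on the set of $i$-geodesics for each $i\leq s$. -}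

module Defs where

open import Data.Nat using (ℕ; zero; suc; _≤_; _<_)
open import Data.Bool using (Bool; true; false)
open import Data.Fin using (Fin)
open import Data.Fin.Subset using (Subset; _∩_; ∣_∣)
open import Data.Fin.Permutation using (Permutation′; _⟨$⟩ʳ_; _∘ₚ_; flip; id)
open import Data.Vec using (Vec; []; _∷_; tabulate; map)
open import Data.Unit using (⊤)
open import Data.Product using (Σ; _×_; _,_; ∃)
open import Relation.Nullary using (¬_)
open import Relation.Binary.PropositionalEquality using (_≡_)

record Digraph (n : ℕ) : Set where
  field
    adj     : Fin n → Fin n → Bool
    irrefl  : ∀ u → adj u u ≡ false
    antisym : ∀ u v → adj u v ≡ true → adj v u ≡ false

module _ {n : ℕ} (Γ : Digraph n) where
  open Digraph Γ

  Arc : Fin n → Fin n → Set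
  Arc u v = adj u v ≡ true

  outNbhd : Fin n → Subset n
  outNbhd v = tabulate (adj v)

  HasValency : ℕ → Set
  HasValency k = ∀ v → ∣ outNbhd v ∣ ≡ k

  IsSArc : ∀ {s} → Vec (Fin n) (suc s) → Set
  IsSArc (v ∷ []) = ⊤
  IsSArc (v ∷ w ∷ vs) = Arc v w × IsSArc (w ∷ vs)

  first : ∀ {s} → Vec (Fin n) (suc s) → Fin n
  first (v ∷ _) = v

  last : ∀ {s} → Vec (Fin n) (suc s) → Fin n
  last (v ∷ []) = v
  last (v ∷ w ∷ vs) = last (w ∷ vs)

  WalkOfLength : Fin n → Fin n → ℕ → Set
  WalkOfLength u v s = Σ (Vec (Fin n) (suc s)) λ p → IsSArc p × first p ≡ u × last p ≡ v

  Dist : Fin n → Fin n → ℕ → Set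
  Dist u v s = WalkOfLength u v s × (∀ t → t < s → ¬ WalkOfLength u v t)

  IsGeodesic : ∀ {s} → Vec (Fin n) (suc s) → Set
  IsGeodesic {s} p = IsSArc p × Dist (first p) (last p) s

  IsAut : Permutation′ n → Set
  IsAut σ = ∀ u v → adj (σ ⟨$⟩ʳ u) (σ ⟨$⟩ʳ v) ≡ adj u v

record Subgroup (n : ℕ) : Set₁ where
  field
    _∈G    : Permutation′ n → Set
    id∈    : id ∈G
    ∘∈     : ∀ σ τ → σ ∈G → τ ∈G → (σ ∘ₚ τ) ∈G
    inv∈   : ∀ σ → σ ∈G → flip σ ∈G

module _ {n : ℕ} (Γ : Digraph n) (G : Subgroup n) where
  open Subgroup G

  IsAutSubgroup : Set
  IsAutSubgroup = ∀ σ → σ ∈G → IsAut Γ σ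

  ArcTransitive : Set
  ArcTransitive = ∀ u v u' v' → Arc Γ u v → Arc Γ u' v' →
    Σ (Permutation′ n) λ g → g ∈G × (g ⟨$⟩ʳ u ≡ u') × (g ⟨$⟩ʳ v ≡ v')

  GeodesicTransitiveAt : ℕ → Set
  GeodesicTransitiveAt i = ∀ (p q : Vec (Fin n) (suc i)) →
    IsGeodesic Γ p → IsGeodesic Γ q →
    Σ (Permutation′ n) λ g → g ∈G × map (g ⟨$⟩ʳ_) p ≡ q

  GeodesicTransitive : ℕ → Set
  GeodesicTransitive s = ∀ i → i ≤ s → GeodesicTransitiveAt i

-- Fix an arc u → v with Γ⁺(u) ∩ Γ⁺(v) = {x, x′}. Then R = Γ⁺(v) ∖ Γ⁺(u) has three points,
-- and (u, v, w) is a 2-geodesic for every w ∈ R, so 2-geodesic-transitivity makes the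
-- arc stabiliser G_uv transitive on R; it therefore contains some g acting on R as a
-- 3-cycle. As g permutes {x, x′}, h = g² fixes x, and h still acts on R as a 3-cycle.
-- An element σ ∈ G carrying (u, v) to (v, x) maps {x, x′} onto Γ⁺(v) ∩ Γ⁺(x); since
-- x ∉ Γ⁺(x), one of σx, σx′ is a point r ∈ R. But h fixes v and x, so r, hr, h²r are
-- three distinct points of the two-element set Γ⁺(v) ∩ Γ⁺(x).

module Submission where

open import Defs
open import Data.Bool using (true)
import Data.Bool as Bool
open import Data.Empty using (⊥-elim)
open import Data.Fin using (Fin; zero; suc; _≟_)
open import Data.Fin.Permutation using (Permutation′; _⟨$⟩ʳ_; _⟨$⟩ˡ_; _∘ₚ_; flip; inverseˡ)
open import Data.Fin.Subset using (Subset; inside; outside; _∈_; _∉_; _∩_; _─_; _-_; ⁅_⁆; ∣_∣)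
open import Data.Fin.Subset.Properties
  using (p─⊥≡p; p─q⊆p; x∈p∧x≢y⇒x∈p-y; x∈p⇒∣p-x∣<∣p∣; x∈⁅x⁆; x∈p∩q⁺; x∈p∩q⁻; x∈p∧x∉q⇒x∈p─q; ∩-comm)
open import Data.Nat using (ℕ; zero; suc; _+_; _<_; s≤s; z≤n)
open import Data.Nat.Properties using (suc-injective; +-suc; n≮0; +-cancelˡ-≡)
open import Data.Product using (Σ; ∃; ∃₂; _×_; _,_; proj₁; proj₂; map)
open import Data.Sum using (_⊎_; inj₁; inj₂)
open import Data.Unit using (tt)
open import Data.Vec using (_∷_; []; here; there)
open import Data.Vec.Properties using (lookup∘tabulate; []=⇒lookup; lookup⇒[]=; ∷-injective)
open import Function using (_∘_)
open import Function.Bundles using (Injection)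
open import Function.Definitions using (Injective)
open import Function.Properties.Inverse using (↔⇒↣)
open import Relation.Nullary using (¬_; Dec; yes; no)
open import Relation.Binary.PropositionalEquality
  using (_≡_; _≢_; refl; sym; trans; cong; subst; ≢-sym; module ≡-Reasoning)

private
  variable
    n : ℕ

module _ {A : Set} where

  Distinct₃ : A → A → A → Set
  Distinct₃ a b c = a ≢ b × b ≢ c × a ≢ c

  record Exactly₂ (P : A → Set) (x y : A) : Set where
    field
      ∈₁    : P x
      ∈₂    : P y
      x≢y   : x ≢ y
      cover : ∀ {z} → P z → z ≡ x ⊎ z ≡ y

  record Exactly₃ (P : A → Set) (a b c : A) : Set where
    field
      ∈₁    : P a
      ∈₂    : P b
      ∈₃    : P c
      a≢b   : a ≢ b
      b≢c   : b ≢ c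
      a≢c   : a ≢ c
      cover : ∀ {z} → P z → z ≡ a ⊎ z ≡ b ⊎ z ≡ c

  Permutes : (A → Set) → (A → A) → Set
  Permutes P f = (∀ {y} → P y → P (f y)) × Injective _≡_ _≡_ f

  ThreeCycle : (A → A) → A → A → A → Set
  ThreeCycle f a b c = f a ≡ b × f b ≡ c × f c ≡ a

  module _ {P Q : A → Set} (P⇒Q : ∀ {y} → P y → Q y) (Q⇒P : ∀ {y} → Q y → P y) where

    Exactly₂-map : ∀ {x y} → Exactly₂ P x y → Exactly₂ Q x y
    Exactly₂-map E = record
      { ∈₁ = P⇒Q ∈₁ ; ∈₂ = P⇒Q ∈₂ ; x≢y = x≢y ; cover = cover ∘ Q⇒P }
      where open Exactly₂ E

    Exactly₃-map : ∀ {a b c} → Exactly₃ P a b c → Exactly₃ Q a b c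
    Exactly₃-map E = record
      { ∈₁ = P⇒Q ∈₁ ; ∈₂ = P⇒Q ∈₂ ; ∈₃ = P⇒Q ∈₃
      ; a≢b = a≢b ; b≢c = b≢c ; a≢c = a≢c ; cover = cover ∘ Q⇒P }
      where open Exactly₃ E

  module _ {P : A → Set} where

    Exactly₃-rotate : ∀ {a b c} → Exactly₃ P a b c → Exactly₃ P b c a
    Exactly₃-rotate E = record
      { ∈₁ = ∈₂ ; ∈₂ = ∈₃ ; ∈₃ = ∈₁
      ; a≢b = b≢c ; b≢c = ≢-sym a≢c ; a≢c = ≢-sym a≢b
      ; cover = rotate ∘ cover
      }
      where
      open Exactly₃ E
      rotate : ∀ {z a b c : A} → z ≡ a ⊎ z ≡ b ⊎ z ≡ c → z ≡ b ⊎ z ≡ c ⊎ z ≡ a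
      rotate (inj₁ z≡a)        = inj₂ (inj₂ z≡a)
      rotate (inj₂ (inj₁ z≡b)) = inj₁ z≡b
      rotate (inj₂ (inj₂ z≡c)) = inj₂ (inj₁ z≡c)

    Exactly₃-swap₁₂ : ∀ {a b c} → Exactly₃ P a b c → Exactly₃ P b a c
    Exactly₃-swap₁₂ E = record
      { ∈₁ = ∈₂ ; ∈₂ = ∈₁ ; ∈₃ = ∈₃
      ; a≢b = ≢-sym a≢b ; b≢c = a≢c ; a≢c = b≢c
      ; cover = swap ∘ cover
      }
      where
      open Exactly₃ E
      swap : ∀ {z a b c : A} → z ≡ a ⊎ z ≡ b ⊎ z ≡ c → z ≡ b ⊎ z ≡ a ⊎ z ≡ c
      swap (inj₁ z≡a)        = inj₂ (inj₁ z≡a)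
      swap (inj₂ (inj₁ z≡b)) = inj₁ z≡b
      swap (inj₂ (inj₂ z≡c)) = inj₂ (inj₂ z≡c)

    Exactly₃-swap₂₃ : ∀ {a b c} → Exactly₃ P a b c → Exactly₃ P a c b
    Exactly₃-swap₂₃ = Exactly₃-swap₁₂ ∘ Exactly₃-rotate ∘ Exactly₃-rotate

    Exactly₂-pigeonhole : ∀ {x y a b c} → Exactly₂ P x y → P a → P b → P c → ¬ Distinct₃ a b c
    Exactly₂-pigeonhole E a∈ b∈ c∈ = pigeon (cover a∈) (cover b∈) (cover c∈)
      where
      open Exactly₂ E
      pigeon : ∀ {x y a b c : A} →
               a ≡ x ⊎ a ≡ y → b ≡ x ⊎ b ≡ y → c ≡ x ⊎ c ≡ y → ¬ Distinct₃ a b c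
      pigeon (inj₁ refl) (inj₁ refl) _           (a≢b , _)       = a≢b refl
      pigeon (inj₂ refl) (inj₂ refl) _           (a≢b , _)       = a≢b refl
      pigeon (inj₁ refl) (inj₂ refl) (inj₁ refl) (_ , _ , a≢c)   = a≢c refl
      pigeon (inj₂ refl) (inj₁ refl) (inj₂ refl) (_ , _ , a≢c)   = a≢c refl
      pigeon (inj₁ refl) (inj₂ refl) (inj₂ refl) (_ , b≢c , _)   = b≢c refl
      pigeon (inj₂ refl) (inj₁ refl) (inj₁ refl) (_ , b≢c , _)   = b≢c refl

    Permutes⇒involutive-on-pair : ∀ {x y f} → Exactly₂ P x y → Permutes P f → f (f x) ≡ x
    Permutes⇒involutive-on-pair {f = f} E (maps , f-inj)
      with Exactly₂.cover E (maps (Exactly₂.∈₁ E))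
    ... | inj₁ fx≡x = trans (cong f fx≡x) fx≡x
    ... | inj₂ fx≡y with Exactly₂.cover E (maps (Exactly₂.∈₂ E))
    ...   | inj₁ fy≡x = trans (cong f fx≡y) fy≡x
    ...   | inj₂ fy≡y = ⊥-elim (Exactly₂.x≢y E (f-inj (trans fx≡y (sym fy≡y))))

    image-of-third : ∀ {a b c a′ b′ c′ f} → Exactly₃ P a b c → Exactly₃ P a′ b′ c′ →
                     Permutes P f → f a ≡ a′ → f b ≡ b′ → f c ≡ c′
    image-of-third E E′ (maps , f-inj) fa≡a′ fb≡b′
      with Exactly₃.cover E′ (maps (Exactly₃.∈₃ E))
    ... | inj₁ fc≡a′        = ⊥-elim (Exactly₃.a≢c E (f-inj (trans fa≡a′ (sym fc≡a′))))
    ... | inj₂ (inj₁ fc≡b′) = ⊥-elim (Exactly₃.b≢c E (f-inj (trans fb≡b′ (sym fc≡b′))))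
    ... | inj₂ (inj₂ fc≡c′) = fc≡c′

    threeCycle-among : ∀ {a b c s t} → Exactly₃ P a b c → Permutes P s → Permutes P t →
                       s a ≡ b → t a ≡ c →
                       ThreeCycle s a b c ⊎ ThreeCycle t a c b ⊎ ThreeCycle (s ∘ t) a c b
    threeCycle-among {s = s} E s-perm@(s-maps , s-inj) t-perm@(t-maps , t-inj) sa≡b ta≡c
      with Exactly₃.cover E (s-maps (Exactly₃.∈₂ E))
    ... | inj₂ (inj₁ sb≡b) = ⊥-elim (Exactly₃.a≢b E (s-inj (trans sa≡b (sym sb≡b))))
    ... | inj₂ (inj₂ sb≡c) =
      inj₁ (sa≡b , sb≡c , image-of-third E (Exactly₃-rotate E) s-perm sa≡b sb≡c)
    ... | inj₁ sb≡a with Exactly₃.cover E (t-maps (Exactly₃.∈₃ E))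
    ...   | inj₂ (inj₂ tc≡c) = ⊥-elim (Exactly₃.a≢c E (t-inj (trans ta≡c (sym tc≡c))))
    ...   | inj₂ (inj₁ tc≡b) =
      inj₂ (inj₁ (ta≡c , tc≡b , image-of-third acb (Exactly₃-rotate acb) t-perm ta≡c tc≡b))
      where acb = Exactly₃-swap₂₃ E
    ...   | inj₁ tc≡a =
      inj₂ (inj₂ (trans (cong s ta≡c) sc≡c , trans (cong s tc≡a) sa≡b , trans (cong s tb≡b) sb≡a))
      where
      acb = Exactly₃-swap₂₃ E
      sc≡c = image-of-third E (Exactly₃-swap₁₂ E) s-perm sa≡b sb≡a
      tb≡b = image-of-third acb (Exactly₃-rotate (Exactly₃-rotate E)) t-perm ta≡c tc≡a

    ThreeCycle⇒Distinct₃ : ∀ {a b c f r} → Exactly₃ P a b c → ThreeCycle f a b c → P r →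
                           Distinct₃ r (f r) (f (f r))
    ThreeCycle⇒Distinct₃ E (fa≡b , fb≡c , fc≡a) r∈ with Exactly₃.cover E r∈
    ... | inj₁ refl        rewrite fa≡b | fb≡c = a≢b , b≢c , a≢c
      where open Exactly₃ E
    ... | inj₂ (inj₁ refl) rewrite fb≡c | fc≡a = b≢c , ≢-sym a≢c , ≢-sym a≢b
      where open Exactly₃ E
    ... | inj₂ (inj₂ refl) rewrite fc≡a | fa≡b = ≢-sym a≢c , a≢b , ≢-sym b≢c
      where open Exactly₃ E

  ThreeCycle-square : ∀ {f a b c} → ThreeCycle f a b c → ThreeCycle (f ∘ f) a c b
  ThreeCycle-square {f} (fa≡b , fb≡c , fc≡a) =
    trans (cong f fa≡b) fb≡c , trans (cong f fc≡a) fa≡b , trans (cong f fb≡c) fc≡a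

  Distinct₃-map : ∀ {f a b c} → Injective _≡_ _≡_ f → Distinct₃ a b c → Distinct₃ (f a) (f b) (f c)
  Distinct₃-map f-inj (a≢b , b≢c , a≢c) = a≢b ∘ f-inj , b≢c ∘ f-inj , a≢c ∘ f-inj

∣p∣≡∣p∩q∣+∣p─q∣ : ∀ (p q : Subset n) → ∣ p ∣ ≡ ∣ p ∩ q ∣ + ∣ p ─ q ∣
∣p∣≡∣p∩q∣+∣p─q∣ []            []            = refl
∣p∣≡∣p∩q∣+∣p─q∣ (inside ∷ p)  (inside ∷ q)  = cong suc (∣p∣≡∣p∩q∣+∣p─q∣ p q)
∣p∣≡∣p∩q∣+∣p─q∣ (inside ∷ p)  (outside ∷ q) =
  trans (cong suc (∣p∣≡∣p∩q∣+∣p─q∣ p q)) (sym (+-suc _ _))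
∣p∣≡∣p∩q∣+∣p─q∣ (outside ∷ p) (inside ∷ q)  = ∣p∣≡∣p∩q∣+∣p─q∣ p q
∣p∣≡∣p∩q∣+∣p─q∣ (outside ∷ p) (outside ∷ q) = ∣p∣≡∣p∩q∣+∣p─q∣ p q

x∈p─q⇒x∉q : ∀ {x} (p q : Subset n) → x ∈ p ─ q → x ∉ q
x∈p─q⇒x∉q (_ ∷ p) (outside ∷ q) (there x∈p─q) (there x∈q) = x∈p─q⇒x∉q p q x∈p─q x∈q
x∈p─q⇒x∉q (_ ∷ p) (inside ∷ q)  (there x∈p─q) (there x∈q) = x∈p─q⇒x∉q p q x∈p─q x∈q

x∈p-y⇒x≢y : ∀ {x y} {p : Subset n} → x ∈ p - y → x ≢ y
x∈p-y⇒x≢y {y = y} {p} x∈p-y refl = x∈p─q⇒x∉q p ⁅ y ⁆ x∈p-y (x∈⁅x⁆ y)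

∣p∣≡0⇒x∉p : ∀ {x} {p : Subset n} → ∣ p ∣ ≡ 0 → x ∉ p
∣p∣≡0⇒x∉p {x = x} {p} ∣p∣≡0 x∈p = n≮0 (subst (∣ p - x ∣ <_) ∣p∣≡0 (x∈p⇒∣p-x∣<∣p∣ x∈p))

∣p∣≡1+k⇒∃x∈p : ∀ {k} (p : Subset n) → ∣ p ∣ ≡ suc k → ∃ λ x → x ∈ p × ∣ p - x ∣ ≡ k
∣p∣≡1+k⇒∃x∈p (inside ∷ p)  ∣p∣≡1+k =
  zero , here , trans (cong ∣_∣ (p─⊥≡p p)) (suc-injective ∣p∣≡1+k)
∣p∣≡1+k⇒∃x∈p (outside ∷ p) ∣p∣≡1+k with ∣p∣≡1+k⇒∃x∈p p ∣p∣≡1+k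
... | x , x∈p , ∣p-x∣≡k = suc x , there x∈p , ∣p-x∣≡k

exactly₂ : (p : Subset n) → ∣ p ∣ ≡ 2 → ∃₂ λ x y → Exactly₂ (_∈ p) x y
exactly₂ p ∣p∣≡2 with ∣p∣≡1+k⇒∃x∈p p ∣p∣≡2
... | x , x∈p , ∣p-x∣≡1 with ∣p∣≡1+k⇒∃x∈p (p - x) ∣p-x∣≡1
... | y , y∈p-x , ∣p-x-y∣≡0 = x , y , record
  { ∈₁ = x∈p ; ∈₂ = p─q⊆p p _ y∈p-x ; x≢y = λ x≡y → x∈p-y⇒x≢y y∈p-x (sym x≡y) ; cover = cover }
  where
  cover : ∀ {z} → z ∈ p → z ≡ x ⊎ z ≡ y
  cover {z} z∈p with z ≟ x | z ≟ y
  ... | yes z≡x | _       = inj₁ z≡x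
  ... | no _    | yes z≡y = inj₂ z≡y
  ... | no z≢x  | no z≢y  =
    ⊥-elim (∣p∣≡0⇒x∉p ∣p-x-y∣≡0 (x∈p∧x≢y⇒x∈p-y (x∈p∧x≢y⇒x∈p-y z∈p z≢x) z≢y))

exactly₃ : (p : Subset n) → ∣ p ∣ ≡ 3 → ∃₂ λ a b → ∃ λ c → Exactly₃ (_∈ p) a b c
exactly₃ p ∣p∣≡3 with ∣p∣≡1+k⇒∃x∈p p ∣p∣≡3
... | a , a∈p , ∣p-a∣≡2 with exactly₂ (p - a) ∣p-a∣≡2
... | b , c , E = a , b , c , record
  { ∈₁ = a∈p ; ∈₂ = p─q⊆p p _ ∈₁ ; ∈₃ = p─q⊆p p _ ∈₂
  ; a≢b = λ a≡b → x∈p-y⇒x≢y ∈₁ (sym a≡b) ; b≢c = x≢y ; a≢c = λ a≡c → x∈p-y⇒x≢y ∈₂ (sym a≡c)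
  ; cover = cover′
  }
  where
  open Exactly₂ E
  cover′ : ∀ {z} → z ∈ p → z ≡ a ⊎ z ≡ b ⊎ z ≡ c
  cover′ {z} z∈p with z ≟ a
  ... | yes z≡a = inj₁ z≡a
  ... | no z≢a  = inj₂ (cover (x∈p∧x≢y⇒x∈p-y z∈p z≢a))

⟨$⟩ʳ-injective : (π : Permutation′ n) → Injective _≡_ _≡_ (π ⟨$⟩ʳ_)
⟨$⟩ʳ-injective π = Injection.injective (↔⇒↣ π)

module _ (Γ : Digraph n) where
  open Digraph Γ

  Arc? : ∀ a b → Dec (Arc Γ a b)
  Arc? a b = adj a b Bool.≟ true

  Arc-irrefl : ∀ {a} → ¬ Arc Γ a a
  Arc-irrefl {a} a→a with trans (sym a→a) (irrefl a)
  ... | ()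

  Arc-asym : ∀ {a b} → Arc Γ a b → ¬ Arc Γ b a
  Arc-asym {a} {b} a→b b→a with trans (sym b→a) (antisym a b a→b)
  ... | ()

  ∈-outNbhd⁻ : ∀ {v y} → y ∈ outNbhd Γ v → Arc Γ v y
  ∈-outNbhd⁻ {v} {y} y∈ = trans (sym (lookup∘tabulate (adj v) y)) ([]=⇒lookup y∈)

  ∈-outNbhd⁺ : ∀ {v y} → Arc Γ v y → y ∈ outNbhd Γ v
  ∈-outNbhd⁺ {v} {y} v→y = lookup⇒[]= y (outNbhd Γ v) (trans (lookup∘tabulate (adj v) y) v→y)

  aut-preserves-Arc : ∀ {σ a b a′ b′} → IsAut Γ σ → σ ⟨$⟩ʳ a ≡ a′ → σ ⟨$⟩ʳ b ≡ b′ →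
                      Arc Γ a b → Arc Γ a′ b′
  aut-preserves-Arc σ-aut refl refl a→b = trans (σ-aut _ _) a→b

  aut-reflects-Arc : ∀ {σ a b a′ b′} → IsAut Γ σ → σ ⟨$⟩ʳ a ≡ a′ → σ ⟨$⟩ʳ b ≡ b′ →
                     Arc Γ a′ b′ → Arc Γ a b
  aut-reflects-Arc σ-aut refl refl a′→b′ = trans (sym (σ-aut _ _)) a′→b′

  walk₀⇒≡ : ∀ {a b} → WalkOfLength Γ a b 0 → a ≡ b
  walk₀⇒≡ ((z ∷ []) , _ , z≡a , z≡b) = trans (sym z≡a) z≡b

  walk₁⇒Arc : ∀ {a b} → WalkOfLength Γ a b 1 → Arc Γ a b
  walk₁⇒Arc ((_ ∷ _ ∷ []) , (a→b , _) , refl , refl) = a→b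

  CommonOut : Fin n → Fin n → Fin n → Set
  CommonOut a b y = Arc Γ a y × Arc Γ b y

  Beyond : Fin n → Fin n → Fin n → Set
  Beyond u v w = Arc Γ v w × ¬ Arc Γ u w

  beyond⇒geodesic : ∀ {u v w} → Arc Γ u v → Beyond u v w → IsGeodesic Γ (u ∷ v ∷ w ∷ [])
  beyond⇒geodesic {u} {v} {w} u→v (v→w , u↛w) = 2-arc , (_ , 2-arc , refl , refl) , no-shortcut
    where
    2-arc : IsSArc Γ (u ∷ v ∷ w ∷ [])
    2-arc = u→v , v→w , tt
    no-shortcut : ∀ t → t < 2 → ¬ WalkOfLength Γ u w t
    no-shortcut 0 _ walk = Arc-asym u→v (subst (Arc Γ v) (sym (walk₀⇒≡ walk)) v→w)
    no-shortcut 1 _ walk = u↛w (walk₁⇒Arc walk)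
    no-shortcut (suc (suc _)) (s≤s (s≤s ()))

  commonOut-exactly₂ : ∀ {u v} → ∣ outNbhd Γ u ∩ outNbhd Γ v ∣ ≡ 2 → ∃₂ (Exactly₂ (CommonOut u v))
  commonOut-exactly₂ {u} {v} ∣N∣≡2 with exactly₂ _ ∣N∣≡2
  ... | x , x′ , N = x , x′ , Exactly₂-map to from N
    where
    to : ∀ {y} → y ∈ outNbhd Γ u ∩ outNbhd Γ v → CommonOut u v y
    to = map ∈-outNbhd⁻ ∈-outNbhd⁻ ∘ x∈p∩q⁻ _ _
    from : ∀ {y} → CommonOut u v y → y ∈ outNbhd Γ u ∩ outNbhd Γ v
    from = x∈p∩q⁺ ∘ map ∈-outNbhd⁺ ∈-outNbhd⁺

  beyond-exactly₃ : ∀ {u v} → HasValency Γ 5 → ∣ outNbhd Γ u ∩ outNbhd Γ v ∣ ≡ 2 →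
                    ∃₂ λ a b → ∃ (Exactly₃ (Beyond u v) a b)
  beyond-exactly₃ {u} {v} valency ∣N∣≡2 with exactly₃ _ ∣R∣≡3
    where
    open ≡-Reasoning
    Γ⁺u = outNbhd Γ u
    Γ⁺v = outNbhd Γ v
    ∣R∣≡3 : ∣ Γ⁺v ─ Γ⁺u ∣ ≡ 3
    ∣R∣≡3 = +-cancelˡ-≡ 2 _ _ (begin
      2 + ∣ Γ⁺v ─ Γ⁺u ∣             ≡⟨ cong (_+ ∣ Γ⁺v ─ Γ⁺u ∣) (sym ∣N∣≡2) ⟩
      ∣ Γ⁺u ∩ Γ⁺v ∣ + ∣ Γ⁺v ─ Γ⁺u ∣ ≡⟨ cong (λ N → ∣ N ∣ + ∣ Γ⁺v ─ Γ⁺u ∣) (∩-comm Γ⁺u Γ⁺v) ⟩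
      ∣ Γ⁺v ∩ Γ⁺u ∣ + ∣ Γ⁺v ─ Γ⁺u ∣ ≡⟨ sym (∣p∣≡∣p∩q∣+∣p─q∣ Γ⁺v Γ⁺u) ⟩
      ∣ Γ⁺v ∣                       ≡⟨ valency v ⟩
      5                             ∎)
  ... | a , b , c , R = a , b , c , Exactly₃-map to from R
    where
    to : ∀ {y} → y ∈ outNbhd Γ v ─ outNbhd Γ u → Beyond u v y
    to y∈ = ∈-outNbhd⁻ (p─q⊆p _ _ y∈) , x∈p─q⇒x∉q _ _ y∈ ∘ ∈-outNbhd⁺
    from : ∀ {y} → Beyond u v y → y ∈ outNbhd Γ v ─ outNbhd Γ u
    from (v→y , u↛y) = x∈p∧x∉q⇒x∈p─q (∈-outNbhd⁺ v→y) (u↛y ∘ ∈-outNbhd⁻)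

  -- x ∉ Γ⁺(x) leaves room for at most one point of Γ⁺(x) inside Γ⁺(u) ∩ Γ⁺(v) = {x, x′}.
  commonOut-meets-Beyond : ∀ {u v x x′ y y′} → Exactly₂ (CommonOut u v) x x′ →
                           CommonOut v x y → CommonOut v x y′ → y ≢ y′ →
                           ∃ λ r → Beyond u v r × Arc Γ x r
  commonOut-meets-Beyond {u} {v} {x} {x′} {y} {y′} N (v→y , x→y) (v→y′ , x→y′) y≢y′
    with Arc? u y | Arc? u y′
  ... | no u↛y  | _        = y , (v→y , u↛y) , x→y
  ... | yes _   | no u↛y′  = y′ , (v→y′ , u↛y′) , x→y′
  ... | yes u→y | yes u→y′ =
    ⊥-elim (y≢y′ (trans (is-x′ u→y v→y x→y) (sym (is-x′ u→y′ v→y′ x→y′))))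
    where
    is-x′ : ∀ {z} → Arc Γ u z → Arc Γ v z → Arc Γ x z → z ≡ x′
    is-x′ u→z v→z x→z with Exactly₂.cover N (u→z , v→z)
    ... | inj₁ refl = ⊥-elim (Arc-irrefl x→z)
    ... | inj₂ z≡x′ = z≡x′

module _ (Γ : Digraph n) (G : Subgroup n) (G≤AutΓ : IsAutSubgroup Γ G) where
  open Subgroup G

  CommonOut-map : ∀ {g a b a′ b′ y} → g ∈G → g ⟨$⟩ʳ a ≡ a′ → g ⟨$⟩ʳ b ≡ b′ →
                  CommonOut Γ a b y → CommonOut Γ a′ b′ (g ⟨$⟩ʳ y)
  CommonOut-map {g} g∈ ga≡a′ gb≡b′ (a→y , b→y) =
    aut-preserves-Arc Γ {σ = g} (G≤AutΓ g g∈) ga≡a′ refl a→y ,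
    aut-preserves-Arc Γ {σ = g} (G≤AutΓ g g∈) gb≡b′ refl b→y

  Stabilises : Permutation′ n → Fin n → Fin n → Set
  Stabilises g u v = g ∈G × g ⟨$⟩ʳ u ≡ u × g ⟨$⟩ʳ v ≡ v

  Stabilises-∘ : ∀ {g h u v} → Stabilises g u v → Stabilises h u v → Stabilises (g ∘ₚ h) u v
  Stabilises-∘ {g} {h} (g∈ , gu≡u , gv≡v) (h∈ , hu≡u , hv≡v) =
    ∘∈ g h g∈ h∈ , trans (cong (h ⟨$⟩ʳ_) gu≡u) hu≡u , trans (cong (h ⟨$⟩ʳ_) gv≡v) hv≡v

  stabiliser-permutes-CommonOut : ∀ {g u v} → Stabilises g u v →
                                  Permutes (CommonOut Γ u v) (g ⟨$⟩ʳ_)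
  stabiliser-permutes-CommonOut {g} (g∈ , gu≡u , gv≡v) =
    CommonOut-map g∈ gu≡u gv≡v , ⟨$⟩ʳ-injective g

  stabiliser-permutes-Beyond : ∀ {g u v} → Stabilises g u v → Permutes (Beyond Γ u v) (g ⟨$⟩ʳ_)
  stabiliser-permutes-Beyond {g} (g∈ , gu≡u , gv≡v) = maps , ⟨$⟩ʳ-injective g
    where
    maps : ∀ {w} → Beyond Γ _ _ w → Beyond Γ _ _ (g ⟨$⟩ʳ w)
    maps (v→w , u↛w) =
      aut-preserves-Arc Γ {σ = g} (G≤AutΓ g g∈) gv≡v refl v→w ,
      u↛w ∘ aut-reflects-Arc Γ {σ = g} (G≤AutΓ g g∈) gu≡u refl

  module _ (geodesic-transitive : GeodesicTransitiveAt Γ G 2) {u v} (u→v : Arc Γ u v) where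

    stabiliser-transitive-on-Beyond : ∀ {w w′} → Beyond Γ u v w → Beyond Γ u v w′ →
                                      ∃ λ g → Stabilises g u v × g ⟨$⟩ʳ w ≡ w′
    stabiliser-transitive-on-Beyond w∈ w′∈
      with geodesic-transitive _ _ (beyond⇒geodesic Γ u→v w∈) (beyond⇒geodesic Γ u→v w′∈)
    ... | g , g∈ , g[uvw]≡[uvw′] with ∷-injective g[uvw]≡[uvw′]
    ... | gu≡u , g[vw]≡[vw′] with ∷-injective g[vw]≡[vw′]
    ... | gv≡v , g[w]≡[w′] = g , (g∈ , gu≡u , gv≡v) , proj₁ (∷-injective g[w]≡[w′])

    threeCycle-in-stabiliser : ∀ {a b c} → Exactly₃ (Beyond Γ u v) a b c →
      ∃ λ g → Stabilises g u v ×
              ∃₂ λ b′ c′ → Exactly₃ (Beyond Γ u v) a b′ c′ × ThreeCycle (g ⟨$⟩ʳ_) a b′ c′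
    threeCycle-in-stabiliser R
      with stabiliser-transitive-on-Beyond (Exactly₃.∈₁ R) (Exactly₃.∈₂ R)
         | stabiliser-transitive-on-Beyond (Exactly₃.∈₁ R) (Exactly₃.∈₃ R)
    ... | s , s-stab , sa≡b | t , t-stab , ta≡c
      with threeCycle-among R (stabiliser-permutes-Beyond s-stab)
                              (stabiliser-permutes-Beyond t-stab) sa≡b ta≡c
    ... | inj₁ s-cycle        = s , s-stab , _ , _ , R , s-cycle
    ... | inj₂ (inj₁ t-cycle) = t , t-stab , _ , _ , Exactly₃-swap₂₃ R , t-cycle
    ... | inj₂ (inj₂ ts-cycle) =
      t ∘ₚ s , Stabilises-∘ t-stab s-stab , _ , _ , Exactly₃-swap₂₃ R , ts-cycle

  ¬geodesicTransitive : ArcTransitive Γ G → ∀ {u v x x′ a b c} → Arc Γ u v →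
                        Exactly₂ (CommonOut Γ u v) x x′ → Exactly₃ (Beyond Γ u v) a b c →
                        ¬ GeodesicTransitiveAt Γ G 2
  ¬geodesicTransitive arc-transitive {u} {v} {x} {x′} u→v N R geodesic-transitive
    with arc-transitive u v v x u→v (proj₂ (Exactly₂.∈₁ N))
  ... | σ , σ∈ , σu≡v , σv≡x
    with commonOut-meets-Beyond Γ N (CommonOut-map σ∈ σu≡v σv≡x (Exactly₂.∈₁ N))
                                    (CommonOut-map σ∈ σu≡v σv≡x (Exactly₂.∈₂ N))
                                    (Exactly₂.x≢y N ∘ ⟨$⟩ʳ-injective σ)
       | threeCycle-in-stabiliser geodesic-transitive u→v R
  ... | r , r-beyond@(v→r , _) , x→r | g , g-stab , _ , _ , R′ , g-cycle =
    Exactly₂-pigeonhole N (τ-maps r∈) (τ-maps (h-maps r∈)) (τ-maps (h-maps (h-maps r∈)))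
      (Distinct₃-map (⟨$⟩ʳ-injective τ) orbit-distinct)
    where
    h = g ∘ₚ g
    τ = flip σ

    r∈ : CommonOut Γ v x r
    r∈ = v→r , x→r

    orbit-distinct : Distinct₃ r (h ⟨$⟩ʳ r) (h ⟨$⟩ʳ (h ⟨$⟩ʳ r))
    orbit-distinct = ThreeCycle⇒Distinct₃ (Exactly₃-swap₂₃ R′) (ThreeCycle-square g-cycle) r-beyond

    h-maps : ∀ {y} → CommonOut Γ v x y → CommonOut Γ v x (h ⟨$⟩ʳ y)
    h-maps = CommonOut-map (proj₁ h-stab) (proj₂ (proj₂ h-stab)) hx≡x
      where
      h-stab = Stabilises-∘ g-stab g-stab
      hx≡x = Permutes⇒involutive-on-pair N (stabiliser-permutes-CommonOut g-stab)

    τ-maps : ∀ {y} → CommonOut Γ v x y → CommonOut Γ u v (τ ⟨$⟩ʳ y)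
    τ-maps = CommonOut-map (inv∈ σ σ∈) (trans (cong (σ ⟨$⟩ˡ_) (sym σu≡v)) (inverseˡ σ))
                                       (trans (cong (σ ⟨$⟩ˡ_) (sym σv≡x)) (inverseˡ σ))

lemma4p8 : (n : ℕ) (Γ : Digraph n) (G : Subgroup n) →
    IsAutSubgroup Γ G → ArcTransitive Γ G → HasValency Γ 5 →
    Σ (Fin n) (λ u → Σ (Fin n) (λ v → Arc Γ u v × ∣ outNbhd Γ u ∩ outNbhd Γ v ∣ ≡ 2)) →
    ¬ GeodesicTransitive Γ G 2
lemma4p8 n Γ G G≤AutΓ arc-transitive valency (u , v , u→v , ∣N∣≡2) geodesic-transitive
  with commonOut-exactly₂ Γ ∣N∣≡2 | beyond-exactly₃ Γ valency ∣N∣≡2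
... | _ , _ , N | _ , _ , _ , R =
  ¬geodesicTransitive Γ G G≤AutΓ arc-transitive u→v N R (geodesic-transitive 2 (s≤s (s≤s z≤n)))
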